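{- Let $m,n\ge1$, $N=m+n\ge3$. For every integer $h$ with $0\le h\le m-1$, $$\mathsf{T}^{mn}_{h}(00)=N\,\frac{m-h}{mn}\binom{m}{h}\binom{n}{m-h},$$ and for every integer $h$ with $0\le h\le n-1$, $$\mathsf{T}^{mn}_{h}(11)=N\,\frac{n-h}{mn}\binom{n}{h}\binom{m}{n-h}.$$
   Context: For a binary word $S=\alpha_1\cdots\alpha_N$ and a binary word $U$ of length $|U|<N$, the number of (cyclic) occurrences of $U$ in $S$ is the number of $i\in\{1,\dots,N\}$ such that $\alpha_i\alpha_{i+1}\cdots\alpha_{i+|U|-1}=U$, indices taken modulo $N$. $\mathsf{T}^{mn}_{h}U$ denotes the number of binary words of length $N=m+n$ with exactly $m$ zeros and $n$ ones in which $U$ occurs exactly $h$ times. Binomial coefficients $\binom{a}{b}$ are $0$ unless $0\le b\le a$. -}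

module Defs where

open import Data.Bool using (Bool; true; false; if_then_else_; _∧_)
open import Data.Nat using (ℕ; zero; suc; _+_; _*_; _<_; _≡ᵇ_)
open import Data.Nat.DivMod using (_%_)
open import Data.Fin using (Fin; toℕ; fromℕ<)
open import Data.Nat.DivMod using (m%n<n)
open import Data.List using (List; filterᵇ; map; length; _++_; concatMap; filter; allFin; zip; upTo)
open import Data.Vec using (Vec; []; _∷_; lookup)
open import Relation.Nullary.Decidable using (_×-dec_)
open import Data.Nat using (_≟_)
import Data.Bool
open import Relation.Nullary.Decidable using (does)
open import Relation.Binary.PropositionalEquality using (_≡_)

-- Binary letters: false = 0, true = 1.

allWords : (N : ℕ) → List (Vec Bool N)
allWords zero = [] Data.List.∷ Data.List.[]
allWords (suc N) = concatMap (λ w → (false ∷ w) Data.List.∷ (true ∷ w) Data.List.∷ Data.List.[]) (allWords N)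

zeros : {N : ℕ} → Vec Bool N → ℕ
zeros [] = 0
zeros (false ∷ w) = suc (zeros w)
zeros (true ∷ w) = zeros w

ones : {N : ℕ} → Vec Bool N → ℕ
ones [] = 0
ones (false ∷ w) = ones w
ones (true ∷ w) = suc (ones w)

at : {N : ℕ} → Vec Bool (suc N) → ℕ → Bool
at {N} w j = lookup w (fromℕ< (m%n<n j (suc N)))

eqBool : Bool → Bool → Bool
eqBool false false = true
eqBool true true = true
eqBool _ _ = false

occursAt : {N : ℕ} → Vec Bool (suc N) → List Bool → ℕ → Bool
occursAt w Data.List.[] i = true
occursAt w (u Data.List.∷ us) i = eqBool (at w i) u ∧ occursAt w us (suc i)

occ : {N : ℕ} → List Bool → Vec Bool N → ℕ
occ {zero} U w = 0
occ {suc N} U w = length (Data.List.filterᵇ (λ i → occursAt w U i) (upTo (suc N)))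

T : (m n h : ℕ) → List Bool → ℕ
T m n h U = length (filter (λ w → ((zeros w ≟ m) ×-dec (ones w ≟ n)) ×-dec (occ U w ≟ h)) (allWords (m + n)))

module Submission where

-- Cutting a cyclic word after its first letter a leaves a linear word v framed by a
-- on both sides.  In a framed word b v e the factors 00 are the zeros minus the runs of
-- zeros, and such a word is determined by how its zeros and its ones split into runs:
-- two compositions whose numbers of parts k and k′ are linked through the frame letters.
-- Peeling off the first letter of v turns this into Pascal's rule for composition
-- numbers, so the framed counts are products of binomial coefficients; the frames 0v0
-- and 1v1 then combine via k·C(m,k) = m·C(m-1,k-1).  Complementing every letter
-- exchanges 00 with 11 and m with n.

open import Defs
open import Data.Bool using (Bool; true; false; not; _∧_; if_then_else_; T?)
open import Data.Empty using (⊥-elim)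
open import Data.Fin using (fromℕ<)
open import Data.List as List using ([]; _∷_; upTo; applyUpTo)
open import Data.List.Properties using (map-upTo)
open import Data.Nat using (ℕ; zero; suc; _+_; _*_; _∸_; _≤_; _<_; _≡ᵇ_; z≤n; s≤s)
open import Data.Nat.Combinatorics using (_C_; nCk+nC[k+1]≡[n+1]C[k+1]; k>n⇒nCk≡0; nC1≡n; nCk≡nC[n∸k])
open import Data.Nat.DivMod using (m%n<n; m<n⇒m%n≡m; n%n≡0)
open import Data.Nat.ListAction using (sum)
open import Data.Nat.Properties
open import Algebra.Properties.CommutativeSemigroup +-commutativeSemigroup using (interchange)
open import Data.Nat.Solver using (module +-*-Solver)
open import Data.Product using (_×_; _,_)
open import Data.Sum using (inj₁; inj₂)
open import Data.Vec as Vec using (Vec; []; _∷_; lookup)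
open import Data.Vec.Properties using (lookup-map)
open import Function using (_∘_)
open import Relation.Nullary using (Dec; does; yes; no)
open import Relation.Binary.PropositionalEquality
open +-*-Solver using (solve; _:+_; _:*_; _:=_)

⟦_⟧ : Bool → ℕ
⟦ b ⟧ = if b then 1 else 0

⟦∧⟧ : ∀ a b → ⟦ a ∧ b ⟧ ≡ ⟦ a ⟧ * ⟦ b ⟧
⟦∧⟧ true  b = sym (+-identityʳ ⟦ b ⟧)
⟦∧⟧ false b = refl

δ : ℕ → ℕ → ℕ
δ m n = ⟦ m ≡ᵇ n ⟧

δ-refl : ∀ n → δ n n ≡ 1
δ-refl zero    = refl
δ-refl (suc n) = δ-refl n

δ-≢ : ∀ {m n} → m ≢ n → δ m n ≡ 0
δ-≢ {zero}  {zero}  m≢n = ⊥-elim (m≢n refl)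
δ-≢ {zero}  {suc n} m≢n = refl
δ-≢ {suc m} {zero}  m≢n = refl
δ-≢ {suc m} {suc n} m≢n = δ-≢ (m≢n ∘ cong suc)

length-filter : ∀ {A : Set} {P : A → Set} (P? : ∀ x → Dec (P x)) xs →
  List.length (List.filter P? xs) ≡ sum (List.map (λ x → ⟦ does (P? x) ⟧) xs)
length-filter P? [] = refl
length-filter P? (x ∷ xs) with does (P? x)
... | true  = cong suc (length-filter P? xs)
... | false = length-filter P? xs

sum-applyUpTo-cong : ∀ n {f g : ℕ → ℕ} → (∀ i → i < n → f i ≡ g i) →
  sum (applyUpTo f n) ≡ sum (applyUpTo g n)
sum-applyUpTo-cong zero    f≗g = refl
sum-applyUpTo-cong (suc n) f≗g =
  cong₂ _+_ (f≗g 0 (s≤s z≤n)) (sum-applyUpTo-cong n (λ i i<n → f≗g (suc i) (s≤s i<n)))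

sumWords : (N : ℕ) → (Vec Bool N → ℕ) → ℕ
sumWords zero    f = f []
sumWords (suc N) f = sumWords N (λ v → f (false ∷ v) + f (true ∷ v))

sumWords-cong : ∀ N {f g : Vec Bool N → ℕ} → (∀ v → f v ≡ g v) → sumWords N f ≡ sumWords N g
sumWords-cong zero    f≗g = f≗g []
sumWords-cong (suc N) f≗g = sumWords-cong N (λ v → cong₂ _+_ (f≗g _) (f≗g _))

sumWords-+ : ∀ N (f g : Vec Bool N → ℕ) → sumWords N (λ v → f v + g v) ≡ sumWords N f + sumWords N g
sumWords-+ zero    f g = refl
sumWords-+ (suc N) f g =
  trans (sumWords-cong N (λ v → interchange (f (false ∷ v)) (g (false ∷ v)) (f (true ∷ v)) (g (true ∷ v))))
        (sumWords-+ N _ _)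

sumWords-0 : ∀ N → sumWords N (λ _ → 0) ≡ 0
sumWords-0 zero    = refl
sumWords-0 (suc N) = sumWords-0 N

sumWords-complement : ∀ N (f : Vec Bool N → ℕ) → sumWords N f ≡ sumWords N (f ∘ Vec.map not)
sumWords-complement zero    f = refl
sumWords-complement (suc N) f =
  trans (sumWords-complement N (λ v → f (false ∷ v) + f (true ∷ v)))
        (sumWords-cong N (λ v → +-comm (f (false ∷ Vec.map not v)) _))

sum-allWords : ∀ N (f : Vec Bool N → ℕ) → sum (List.map f (allWords N)) ≡ sumWords N f
sum-allWords zero    f = +-identityʳ (f [])
sum-allWords (suc N) f = trans (pairUp (allWords N)) (sum-allWords N _)
  where
  pairUp : ∀ ws → sum (List.map f (List.concatMap (λ w → (false ∷ w) ∷ (true ∷ w) ∷ []) ws))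
                ≡ sum (List.map (λ w → f (false ∷ w) + f (true ∷ w)) ws)
  pairUp []       = refl
  pairUp (w ∷ ws) = trans (sym (+-assoc (f (false ∷ w)) _ _)) (cong (_ +_) (pairUp ws))

T≡sumWords : ∀ m n h U →
  T m n h U ≡ sumWords (m + n) (λ w → δ (zeros w) m * δ (ones w) n * δ (occ U w) h)
T≡sumWords m n h U = begin
  T m n h U
    ≡⟨ length-filter _ (allWords (m + n)) ⟩
  sum (List.map (λ w → ⟦ ((zeros w ≡ᵇ m) ∧ (ones w ≡ᵇ n)) ∧ (occ U w ≡ᵇ h) ⟧) (allWords (m + n)))
    ≡⟨ sum-allWords (m + n) _ ⟩
  sumWords (m + n) (λ w → ⟦ ((zeros w ≡ᵇ m) ∧ (ones w ≡ᵇ n)) ∧ (occ U w ≡ᵇ h) ⟧)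
    ≡⟨ sumWords-cong (m + n) (λ w → trans (⟦∧⟧ _ (occ U w ≡ᵇ h))
                                          (cong (_* δ (occ U w) h) (⟦∧⟧ (zeros w ≡ᵇ m) _))) ⟩
  sumWords (m + n) (λ w → δ (zeros w) m * δ (ones w) n * δ (occ U w) h) ∎
  where open ≡-Reasoning

zeros-≤ : ∀ {N} (v : Vec Bool N) → zeros v ≤ N
zeros-≤ []          = z≤n
zeros-≤ (false ∷ v) = s≤s (zeros-≤ v)
zeros-≤ (true ∷ v)  = m≤n⇒m≤1+n (zeros-≤ v)

zeros+ones : ∀ {N} (w : Vec Bool N) → zeros w + ones w ≡ N
zeros+ones []          = refl
zeros+ones (false ∷ w) = cong suc (zeros+ones w)
zeros+ones (true ∷ w)  = trans (+-suc (zeros w) (ones w)) (cong suc (zeros+ones w))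

δ-zeros-ones : ∀ {N} (w : Vec Bool N) m n → N ≡ m + n → δ (zeros w) m * δ (ones w) n ≡ δ (zeros w) m
δ-zeros-ones w m n N≡m+n with zeros w ≟ m
... | yes refl = trans (cong (δ (zeros w) m *_) (trans (cong (λ o → δ o n) ones≡n) (δ-refl n))) (*-identityʳ _)
  where
  ones≡n : ones w ≡ n
  ones≡n = +-cancelˡ-≡ (zeros w) (ones w) n (trans (zeros+ones w) N≡m+n)
... | no zeros≢m rewrite δ-≢ zeros≢m = refl

zeros-complement : ∀ {N} (w : Vec Bool N) → zeros (Vec.map not w) ≡ ones w
zeros-complement []          = refl
zeros-complement (false ∷ w) = zeros-complement w
zeros-complement (true ∷ w)  = cong suc (zeros-complement w)

ones-complement : ∀ {N} (w : Vec Bool N) → ones (Vec.map not w) ≡ zeros w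
ones-complement []          = refl
ones-complement (false ∷ w) = cong suc (ones-complement w)
ones-complement (true ∷ w)  = ones-complement w

-- The first clause makes  zeroPair b true  reduce for a variable b.
zeroPair : Bool → Bool → ℕ
zeroPair b     true  = 0
zeroPair true  false = 0
zeroPair false false = 1

zeroPairs : ∀ {N} → Bool → Vec Bool N → Bool → ℕ
zeroPairs b []      e = zeroPair b e
zeroPairs b (a ∷ v) e = zeroPair b a + zeroPairs a v e

zeroPairs-≤ : ∀ {N} b (v : Vec Bool N) e → zeroPairs b v e ≤ zeros (b ∷ v)
zeroPairs-≤ false []          false = s≤s z≤n
zeroPairs-≤ false []          true  = z≤n
zeroPairs-≤ true  []          false = z≤n
zeroPairs-≤ true  []          true  = z≤n
zeroPairs-≤ false (false ∷ v) e     = s≤s (zeroPairs-≤ false v e)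
zeroPairs-≤ false (true ∷ v)  e     = m≤n⇒m≤1+n (zeroPairs-≤ true v e)
zeroPairs-≤ true  (false ∷ v) e     = zeroPairs-≤ false v e
zeroPairs-≤ true  (true ∷ v)  e     = zeroPairs-≤ true v e

zeroPairs-false-≤ : ∀ {N} (v : Vec Bool N) e → zeroPairs false v e ≤ zeros v + zeros (e ∷ [])
zeroPairs-false-≤ []          false = s≤s z≤n
zeroPairs-false-≤ []          true  = z≤n
zeroPairs-false-≤ (false ∷ v) e     = s≤s (zeroPairs-false-≤ v e)
zeroPairs-false-≤ (true ∷ v)  e     = ≤-trans (zeroPairs-≤ true v e) (m≤m+n (zeros v) (zeros (e ∷ [])))

letterAt : ∀ {N} → Vec Bool N → Bool → ℕ → Bool
letterAt []      e i       = e
letterAt (a ∷ v) e zero    = a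
letterAt (a ∷ v) e (suc i) = letterAt v e i

letterAt-end : ∀ {N} (v : Vec Bool N) e → letterAt v e N ≡ e
letterAt-end []      e = refl
letterAt-end (a ∷ v) e = letterAt-end v e

lookup-fromℕ< : ∀ {N} (v : Vec Bool N) e {i} (i<N : i < N) → lookup v (fromℕ< i<N) ≡ letterAt v e i
lookup-fromℕ< (a ∷ v) e {zero}  _         = refl
lookup-fromℕ< (a ∷ v) e {suc i} (s≤s i<N) = lookup-fromℕ< v e i<N

at≡letterAt : ∀ {N} a (v : Vec Bool N) {i} → i ≤ suc N → at (a ∷ v) i ≡ letterAt (a ∷ v) a i
at≡letterAt {N} a v {i} i≤1+N with m≤n⇒m<n∨m≡n i≤1+N
... | inj₁ i<1+N = trans (lookup-fromℕ< (a ∷ v) a (m%n<n i (suc N)))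
                         (cong (letterAt (a ∷ v) a) (m<n⇒m%n≡m i<1+N))
... | inj₂ refl  = trans (lookup-fromℕ< (a ∷ v) a (m%n<n i (suc N)))
                         (trans (cong (letterAt (a ∷ v) a) (n%n≡0 (suc N))) (sym (letterAt-end v a)))

occ≡sum : ∀ {N} U (w : Vec Bool (suc N)) →
  occ U w ≡ sum (applyUpTo (λ i → ⟦ occursAt w U i ⟧) (suc N))
occ≡sum {N} U w =
  trans (length-filter (λ i → T? (occursAt w U i)) (upTo (suc N)))
        (cong sum (map-upTo (λ i → ⟦ occursAt w U i ⟧) (suc N)))

sum-zeroPair-letterAt : ∀ {N} b (v : Vec Bool N) e →
  sum (applyUpTo (λ i → zeroPair (letterAt (b ∷ v) e i) (letterAt (b ∷ v) e (suc i))) (suc N))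
    ≡ zeroPairs b v e
sum-zeroPair-letterAt b []      e = +-identityʳ (zeroPair b e)
sum-zeroPair-letterAt b (a ∷ v) e = cong (zeroPair b a +_) (sum-zeroPair-letterAt a v e)

⟦occurs00⟧ : ∀ x y → ⟦ eqBool x false ∧ (eqBool y false ∧ true) ⟧ ≡ zeroPair x y
⟦occurs00⟧ false false = refl
⟦occurs00⟧ false true  = refl
⟦occurs00⟧ true  false = refl
⟦occurs00⟧ true  true  = refl

occ00≡zeroPairs : ∀ {N} a (v : Vec Bool N) → occ (false ∷ false ∷ []) (a ∷ v) ≡ zeroPairs a v a
occ00≡zeroPairs {N} a v = begin
  occ (false ∷ false ∷ []) (a ∷ v)
    ≡⟨ occ≡sum (false ∷ false ∷ []) (a ∷ v) ⟩
  sum (applyUpTo (λ i → ⟦ occursAt (a ∷ v) (false ∷ false ∷ []) i ⟧) (suc N))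
    ≡⟨ sum-applyUpTo-cong (suc N) (λ i i<1+N →
         trans (cong₂ (λ x y → ⟦ eqBool x false ∧ (eqBool y false ∧ true) ⟧)
                      (at≡letterAt a v (<⇒≤ i<1+N)) (at≡letterAt a v i<1+N))
               (⟦occurs00⟧ (letterAt (a ∷ v) a i) (letterAt (a ∷ v) a (suc i)))) ⟩
  sum (applyUpTo (λ i → zeroPair (letterAt (a ∷ v) a i) (letterAt (a ∷ v) a (suc i))) (suc N))
    ≡⟨ sum-zeroPair-letterAt a v a ⟩
  zeroPairs a v a ∎
  where open ≡-Reasoning

eqBool-not : ∀ x u → eqBool (not x) (not u) ≡ eqBool x u
eqBool-not false false = refl
eqBool-not false true  = refl
eqBool-not true  false = refl
eqBool-not true  true  = refl

occursAt-complement : ∀ {N} (w : Vec Bool (suc N)) U i →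
  occursAt (Vec.map not w) (List.map not U) i ≡ occursAt w U i
occursAt-complement w []      i = refl
occursAt-complement w (u ∷ U) i =
  cong₂ _∧_ (trans (cong (λ x → eqBool x (not u)) (lookup-map _ not w)) (eqBool-not _ u))
            (occursAt-complement w U (suc i))

occ-complement : ∀ {N} U (w : Vec Bool N) → occ (List.map not U) (Vec.map not w) ≡ occ U w
occ-complement {zero}  U w = refl
occ-complement {suc N} U w =
  trans (occ≡sum (List.map not U) (Vec.map not w))
        (trans (sum-applyUpTo-cong (suc N) (λ i _ → cong ⟦_⟧ (occursAt-complement w U i)))
               (sym (occ≡sum U w)))

T11≡T00 : ∀ m n h → T m n h (true ∷ true ∷ []) ≡ T n m h (false ∷ false ∷ [])
T11≡T00 m n h = begin
  T m n h (true ∷ true ∷ [])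
    ≡⟨ T≡sumWords m n h (true ∷ true ∷ []) ⟩
  sumWords (m + n) (λ w → δ (zeros w) m * δ (ones w) n * δ (occ (true ∷ true ∷ []) w) h)
    ≡⟨ sumWords-complement (m + n) _ ⟩
  sumWords (m + n) (λ w → δ (zeros (Vec.map not w)) m * δ (ones (Vec.map not w)) n
                          * δ (occ (true ∷ true ∷ []) (Vec.map not w)) h)
    ≡⟨ sumWords-cong (m + n) complement ⟩
  sumWords (m + n) count00
    ≡⟨ cong (λ N → sumWords N count00) (+-comm m n) ⟩
  sumWords (n + m) count00
    ≡⟨ T≡sumWords n m h (false ∷ false ∷ []) ⟨
  T n m h (false ∷ false ∷ []) ∎
  where
  open ≡-Reasoning
  count00 : ∀ {N} → Vec Bool N → ℕ
  count00 w = δ (zeros w) n * δ (ones w) m * δ (occ (false ∷ false ∷ []) w) h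
  complement : ∀ {N} (w : Vec Bool N) →
    δ (zeros (Vec.map not w)) m * δ (ones (Vec.map not w)) n * δ (occ (true ∷ true ∷ []) (Vec.map not w)) h
      ≡ δ (zeros w) n * δ (ones w) m * δ (occ (false ∷ false ∷ []) w) h
  complement w = cong₂ _*_ (trans (cong₂ (λ z o → δ z m * δ o n) (zeros-complement w) (ones-complement w))
                                  (*-comm (δ (ones w) m) (δ (zeros w) n)))
                           (cong (λ o → δ o h) (occ-complement (false ∷ false ∷ []) w))

compositions : ℕ → ℕ → ℕ
compositions zero    zero    = 1
compositions zero    (suc k) = 0
compositions (suc a) zero    = 0
compositions (suc a) (suc k) = a C k

compositions-pascal : ∀ a k → compositions (suc a) (suc k) ≡ compositions a k + compositions a (suc k)
compositions-pascal zero    zero    = refl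
compositions-pascal zero    (suc k) = refl
compositions-pascal (suc a) zero    = refl
compositions-pascal (suc a) (suc k) = sym (nCk+nC[k+1]≡[n+1]C[k+1] a k)

compositions-vanish : ∀ {a k} → a < k → compositions a k ≡ 0
compositions-vanish {zero}  {suc k} _         = refl
compositions-vanish {suc a} {suc k} (s≤s a<k) = k>n⇒nCk≡0 a<k

framedCount : Bool → Bool → (N p h : ℕ) → ℕ
framedCount b e N p h = sumWords N (λ v → δ (zeros v) p * δ (zeroPairs b v e) h)

startingWithZero : Bool → Bool → (N p h : ℕ) → ℕ
startingWithZero b e N p h = sumWords N (λ v → δ (suc (zeros v)) p * δ (zeroPair b false + zeroPairs false v e) h)

framedCount-suc : ∀ b e N p h → framedCount b e (suc N) p h ≡ startingWithZero b e N p h + framedCount true e N p h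
framedCount-suc b e N p h = sumWords-+ N _ _

framedCount-vanish : ∀ b e N p h → (∀ v → zeros v ≡ p → zeroPairs b v e ≢ h) → framedCount b e N p h ≡ 0
framedCount-vanish b e N p h none = trans (sumWords-cong N term≡0) (sumWords-0 N)
  where
  term≡0 : ∀ v → δ (zeros v) p * δ (zeroPairs b v e) h ≡ 0
  term≡0 v with zeros v ≟ p
  ... | yes zeros≡p = trans (cong (δ (zeros v) p *_) (δ-≢ (none v zeros≡p))) (*-zeroʳ (δ (zeros v) p))
  ... | no  zeros≢p = cong (_* δ (zeroPairs b v e) h) (δ-≢ zeros≢p)

framedCount-tooShort : ∀ b e N p h → N < p → framedCount b e N p h ≡ 0
framedCount-tooShort b e N p h N<p =
  framedCount-vanish b e N p h (λ v zeros≡p _ → <⇒≱ N<p (subst (_≤ N) zeros≡p (zeros-≤ v)))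

framedCount-true-tooManyPairs : ∀ e N p h → p < h → framedCount true e N p h ≡ 0
framedCount-true-tooManyPairs e N p h p<h =
  framedCount-vanish true e N p h (λ { v refl refl → <⇒≱ p<h (zeroPairs-≤ true v e) })

framedCount-false-tooManyPairs : ∀ e N p h → p + zeros (e ∷ []) < h → framedCount false e N p h ≡ 0
framedCount-false-tooManyPairs e N p h bound =
  framedCount-vanish false e N p h (λ { v refl refl → <⇒≱ bound (zeroPairs-false-≤ v e) })

-- k and k′ are the numbers of runs of zeros and of runs of ones in the word b v e.
FramedCountFormula : Bool → Bool → ℕ → Set
FramedCountFormula b e N = ∀ p q h k k′ → p + q ≡ N →
  h + k ≡ p + zeros (b ∷ e ∷ []) → k + ones (b ∷ e ∷ []) ≡ suc k′ →
  framedCount b e N p h ≡ compositions (p + zeros (b ∷ e ∷ [])) k * compositions (q + ones (b ∷ e ∷ [])) k′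

framedCount-empty : ∀ b e → FramedCountFormula b e 0
framedCount-empty false false zero zero zero .2 .1 refl refl refl = refl
framedCount-empty false false zero zero 1    .1 .0 refl refl refl = refl
framedCount-empty false false zero zero 2    .0 k′ refl refl ()
framedCount-empty false true  zero zero zero .1 .1 refl refl refl = refl
framedCount-empty false true  zero zero 1    .0 .0 refl refl refl = refl
framedCount-empty true  false zero zero zero .1 .1 refl refl refl = refl
framedCount-empty true  false zero zero 1    .0 .0 refl refl refl = refl
framedCount-empty true  true  zero zero zero .0 .1 refl refl refl = refl

-- The Pascal term for a first letter that cannot occur (no zero, resp. no one, left) vanishes.
absentZeroBranch : ∀ e q k k′ → k + ones (e ∷ []) ≡ suc k′ →
  compositions (zeros (e ∷ [])) k * compositions (suc q + ones (e ∷ [])) k′ ≡ 0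
absentZeroBranch true  q zero          .0 refl = refl
absentZeroBranch true  q (suc k)       k′ _    = refl
absentZeroBranch false q (suc zero)    .0 refl = refl
absentZeroBranch false q (suc (suc k)) k′ _    = refl

absentOneBranch : ∀ e a k k′ → k + suc (ones (e ∷ [])) ≡ suc k′ →
  compositions (suc a) k * compositions (ones (e ∷ [])) k′ ≡ 0
absentOneBranch e a zero    k′ _    = refl
absentOneBranch e a (suc k) ._ refl =
  trans (cong (compositions (suc a) (suc k) *_) (compositions-vanish (m≤n+m (suc (ones (e ∷ []))) k)))
        (*-zeroʳ (compositions (suc a) (suc k)))

startingWithOne-formula : ∀ e N → FramedCountFormula true e N →
  ∀ p q h k k′ → p + q ≡ suc N → h + k ≡ p + zeros (e ∷ []) → k + suc (ones (e ∷ [])) ≡ suc k′ →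
  framedCount true e N p h ≡ compositions (p + zeros (e ∷ [])) k * compositions (q + ones (e ∷ [])) k′
startingWithOne-formula e N formula p (suc q) h k k′ p+q≡ hk kk =
  trans (formula p q h k k′ (suc-injective (trans (sym (+-suc p q)) p+q≡)) hk kk)
        (cong (λ x → compositions (p + zeros (e ∷ [])) k * compositions x k′) (+-suc q (ones (e ∷ []))))
startingWithOne-formula e N formula p zero h k k′ p+0≡ hk kk =
  trans (framedCount-tooShort true e N p h (subst (N <_) (sym p≡1+N) ≤-refl))
        (sym (subst (λ p → compositions (p + zeros (e ∷ [])) k * compositions (ones (e ∷ [])) k′ ≡ 0)
                    (sym p≡1+N) (absentOneBranch e (N + zeros (e ∷ [])) k k′ kk)))
  where
  p≡1+N : p ≡ suc N
  p≡1+N = trans (sym (+-identityʳ p)) p+0≡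

startingWithZero-formula₁ : ∀ e N → FramedCountFormula false e N →
  ∀ p q h k k′ → p + q ≡ suc N → h + k ≡ p + zeros (e ∷ []) → k + ones (e ∷ []) ≡ suc k′ →
  startingWithZero true e N p h ≡ compositions (p + zeros (e ∷ [])) k * compositions (q + ones (e ∷ [])) k′
startingWithZero-formula₁ e N formula zero .(suc N) h k k′ refl hk kk =
  trans (sumWords-0 N) (sym (absentZeroBranch e N k k′ kk))
startingWithZero-formula₁ e N formula (suc p) q h k k′ p+q≡ hk kk =
  trans (formula p q h k k′ (suc-injective p+q≡) (trans hk (sym (+-suc p (zeros (e ∷ []))))) kk)
        (cong (λ x → compositions x k * compositions (q + ones (e ∷ [])) k′) (+-suc p (zeros (e ∷ []))))

startingWithZero-formula₀ : ∀ e N → FramedCountFormula false e N →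
  ∀ p q h k k′ → p + q ≡ suc N →
  h + suc k ≡ p + suc (zeros (e ∷ [])) → suc k + ones (e ∷ []) ≡ suc k′ →
  startingWithZero false e N p h ≡ compositions (p + zeros (e ∷ [])) (suc k) * compositions (q + ones (e ∷ [])) k′
startingWithZero-formula₀ e N formula zero .(suc N) h k k′ refl hk kk =
  trans (sumWords-0 N) (sym (absentZeroBranch e N (suc k) k′ kk))
startingWithZero-formula₀ e N formula (suc p) q zero k k′ p+q≡ hk kk =
  trans (trans (sumWords-cong N (λ v → *-zeroʳ (δ (zeros v) p))) (sumWords-0 N))
        (sym (cong (_* compositions (q + ones (e ∷ [])) k′) (compositions-vanish (s≤s p+z≤k))))
  where
  p+z≤k : suc p + zeros (e ∷ []) ≤ k
  p+z≤k = ≤-reflexive (trans (sym (+-suc p (zeros (e ∷ [])))) (sym (suc-injective hk)))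
startingWithZero-formula₀ e N formula (suc p) q (suc h) k k′ p+q≡ hk kk =
  trans (formula p q h (suc k) k′ (suc-injective p+q≡) (suc-injective hk) kk)
        (cong (λ x → compositions x (suc k) * compositions (q + ones (e ∷ [])) k′) (+-suc p (zeros (e ∷ []))))

framedCount-false-step : ∀ e N → FramedCountFormula false e N → FramedCountFormula true e N →
  FramedCountFormula false e (suc N)
framedCount-false-step e N _ _ p q h zero k′ _ hk _ =
  trans (framedCount-false-tooManyPairs e (suc N) p h (≤-reflexive (sym h≡)))
        (sym (cong (λ a → compositions a 0 * compositions (q + ones (e ∷ [])) k′) (+-suc p (zeros (e ∷ [])))))
  where
  h≡ : h ≡ suc (p + zeros (e ∷ []))
  h≡ = trans (sym (+-identityʳ h)) (trans hk (+-suc p (zeros (e ∷ []))))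
framedCount-false-step e N formula₀ formula₁ p q h (suc k) k′ p+q≡ hk kk = begin
  framedCount false e (suc N) p h
    ≡⟨ framedCount-suc false e N p h ⟩
  startingWithZero false e N p h + framedCount true e N p h
    ≡⟨ cong₂ _+_ (startingWithZero-formula₀ e N formula₀ p q h k k′ p+q≡ hk kk)
                 (startingWithOne-formula e N formula₁ p q h k k′ p+q≡ hk′ (trans (+-suc k oₑ) kk)) ⟩
  compositions (p + zₑ) (suc k) * Y + compositions (p + zₑ) k * Y
    ≡⟨ *-distribʳ-+ Y (compositions (p + zₑ) (suc k)) _ ⟨
  (compositions (p + zₑ) (suc k) + compositions (p + zₑ) k) * Y
    ≡⟨ cong (_* Y) (trans (+-comm (compositions (p + zₑ) (suc k)) _) (sym (compositions-pascal (p + zₑ) k))) ⟩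
  compositions (suc (p + zₑ)) (suc k) * Y
    ≡⟨ cong (λ a → compositions a (suc k) * Y) (+-suc p zₑ) ⟨
  compositions (p + suc zₑ) (suc k) * Y ∎
  where
  open ≡-Reasoning
  zₑ = zeros (e ∷ [])
  oₑ = ones (e ∷ [])
  Y = compositions (q + oₑ) k′
  hk′ : h + k ≡ p + zₑ
  hk′ = suc-injective (trans (sym (+-suc h k)) (trans hk (+-suc p zₑ)))

framedCount-true-step : ∀ e N → FramedCountFormula false e N → FramedCountFormula true e N →
  FramedCountFormula true e (suc N)
framedCount-true-step false N _ _ p q h zero zero _ hk refl =
  trans (framedCount-true-tooManyPairs false (suc N) p h (≤-reflexive (sym h≡)))
        (sym (cong (λ a → compositions a 0 * compositions (q + 1) 0) (+-comm p 1)))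
  where
  h≡ : h ≡ suc p
  h≡ = trans (sym (+-identityʳ h)) (trans hk (+-comm p 1))
framedCount-true-step e N _ _ p q h (suc k) zero _ _ kk = ⊥-elim (m+1+n≢0 k (suc-injective kk))
framedCount-true-step e N formula₀ formula₁ p q h k (suc k′) p+q≡ hk kk = begin
  framedCount true e (suc N) p h
    ≡⟨ framedCount-suc true e N p h ⟩
  startingWithZero true e N p h + framedCount true e N p h
    ≡⟨ cong₂ _+_ (startingWithZero-formula₁ e N formula₀ p q h k k′ p+q≡ hk kk′)
                 (startingWithOne-formula e N formula₁ p q h k (suc k′) p+q≡ hk kk) ⟩
  X * compositions (q + oₑ) k′ + X * compositions (q + oₑ) (suc k′)
    ≡⟨ *-distribˡ-+ X (compositions (q + oₑ) k′) _ ⟨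
  X * (compositions (q + oₑ) k′ + compositions (q + oₑ) (suc k′))
    ≡⟨ cong (X *_) (sym (compositions-pascal (q + oₑ) k′)) ⟩
  X * compositions (suc (q + oₑ)) (suc k′)
    ≡⟨ cong (λ b → X * compositions b (suc k′)) (+-suc q oₑ) ⟨
  X * compositions (q + suc oₑ) (suc k′) ∎
  where
  open ≡-Reasoning
  oₑ = ones (e ∷ [])
  X = compositions (p + zeros (e ∷ [])) k
  kk′ : k + oₑ ≡ suc k′
  kk′ = suc-injective (trans (sym (+-suc k oₑ)) kk)

framedCount≡compositions : ∀ b e N → FramedCountFormula b e N
framedCount≡compositions b     e zero    = framedCount-empty b e
framedCount≡compositions false e (suc N) =
  framedCount-false-step e N (framedCount≡compositions false e N) (framedCount≡compositions true e N)
framedCount≡compositions true  e (suc N) =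
  framedCount-true-step e N (framedCount≡compositions false e N) (framedCount≡compositions true e N)

framedCount-00 : ∀ m′ n j h → h + j ≡ m′ →
  framedCount false false (m′ + n) m′ h ≡ (suc m′ C suc j) * compositions n (suc j)
framedCount-00 m′ n j h h+j≡m′ =
  trans (framedCount≡compositions false false (m′ + n) m′ n h (suc (suc j)) (suc j)
           refl h+k≡ (+-identityʳ (suc (suc j))))
        (cong₂ (λ a b → compositions a (suc (suc j)) * compositions b (suc j)) (+-comm m′ 2) (+-identityʳ n))
  where
  h+k≡ : h + suc (suc j) ≡ m′ + 2
  h+k≡ = trans (trans (+-suc h (suc j)) (cong suc (trans (+-suc h j) (cong suc h+j≡m′)))) (+-comm 2 m′)

framedCount-11 : ∀ m′ n′ j h → h + j ≡ m′ →
  framedCount true true (m′ + suc n′) (suc m′) h ≡ (m′ C j) * (suc n′ C suc j)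
framedCount-11 m′ n′ j h h+j≡m′ =
  trans (framedCount≡compositions true true (m′ + suc n′) (suc m′) n′ h (suc j) (suc (suc j))
           (sym (+-suc m′ n′)) h+k≡ (+-comm (suc j) 2))
        (cong₂ (λ a b → compositions a (suc j) * compositions b (suc (suc j)))
               (+-identityʳ (suc m′)) (+-comm n′ 2))
  where
  h+k≡ : h + suc j ≡ suc m′ + 0
  h+k≡ = trans (+-suc h j) (cong suc (trans h+j≡m′ (sym (+-identityʳ m′))))

T00≡framedCounts : ∀ m′ n h → T (suc m′) n h (false ∷ false ∷ [])
  ≡ framedCount false false (m′ + n) m′ h + framedCount true true (m′ + n) (suc m′) h
T00≡framedCounts m′ n h = begin
  T (suc m′) n h (false ∷ false ∷ [])
    ≡⟨ T≡sumWords (suc m′) n h (false ∷ false ∷ []) ⟩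
  sumWords (suc (m′ + n)) (λ w → δ (zeros w) (suc m′) * δ (ones w) n * δ (occ (false ∷ false ∷ []) w) h)
    ≡⟨ sumWords-cong (suc (m′ + n)) cut ⟩
  sumWords (suc (m′ + n)) (λ w → δ (zeros w) (suc m′) * δ (cyclicZeroPairs w) h)
    ≡⟨ sumWords-+ (m′ + n) _ _ ⟩
  framedCount false false (m′ + n) m′ h + framedCount true true (m′ + n) (suc m′) h ∎
  where
  open ≡-Reasoning
  cyclicZeroPairs : Vec Bool (suc (m′ + n)) → ℕ
  cyclicZeroPairs (a ∷ v) = zeroPairs a v a
  cut : ∀ w → δ (zeros w) (suc m′) * δ (ones w) n * δ (occ (false ∷ false ∷ []) w) h
            ≡ δ (zeros w) (suc m′) * δ (cyclicZeroPairs w) h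
  cut (a ∷ v) = cong₂ _*_ (δ-zeros-ones (a ∷ v) (suc m′) n refl) (cong (λ o → δ o h) (occ00≡zeroPairs a v))

[k+1]*[n+1]C[k+1]≡[n+1]*nCk : ∀ n k → suc k * (suc n C suc k) ≡ suc n * (n C k)
[k+1]*[n+1]C[k+1]≡[n+1]*nCk zero    zero    = refl
[k+1]*[n+1]C[k+1]≡[n+1]*nCk zero    (suc k) = *-zeroʳ (suc (suc k))
[k+1]*[n+1]C[k+1]≡[n+1]*nCk (suc n) zero    =
  trans (*-identityˡ _) (trans (nC1≡n (suc (suc n))) (sym (*-identityʳ (suc (suc n)))))
[k+1]*[n+1]C[k+1]≡[n+1]*nCk (suc n) (suc k) = begin
  suc (suc k) * (suc (suc n) C suc (suc k))
    ≡⟨ cong (suc (suc k) *_) (nCk+nC[k+1]≡[n+1]C[k+1] (suc n) (suc k)) ⟨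
  suc (suc k) * (X + suc n C suc (suc k))
    ≡⟨ *-distribˡ-+ (suc (suc k)) X _ ⟩
  X + suc k * X + suc (suc k) * (suc n C suc (suc k))
    ≡⟨ cong₂ (λ a b → X + a + b) ([k+1]*[n+1]C[k+1]≡[n+1]*nCk n k)
                                 ([k+1]*[n+1]C[k+1]≡[n+1]*nCk n (suc k)) ⟩
  X + suc n * (n C k) + suc n * (n C suc k)
    ≡⟨ +-assoc X _ _ ⟩
  X + (suc n * (n C k) + suc n * (n C suc k))
    ≡⟨ cong (X +_) (trans (sym (*-distribˡ-+ (suc n) (n C k) _))
                          (cong (suc n *_) (nCk+nC[k+1]≡[n+1]C[k+1] n k))) ⟩
  suc (suc n) * X ∎
  where
  open ≡-Reasoning
  X = suc n C suc k

mn[XU+VY]≡[m+n]kXY : ∀ m n k X Y U V → k * X ≡ m * V → k * Y ≡ n * U →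
  m * n * (X * U + V * Y) ≡ (m + n) * k * X * Y
mn[XU+VY]≡[m+n]kXY m n k X Y U V kX≡mV kY≡nU = begin
  m * n * (X * U + V * Y)             ≡⟨ regroup m n X Y U V ⟩
  m * X * (n * U) + n * Y * (m * V)   ≡⟨ cong₂ (λ a b → m * X * a + n * Y * b) kY≡nU kX≡mV ⟨
  m * X * (k * Y) + n * Y * (k * X)   ≡⟨ collect m n k X Y ⟩
  (m + n) * k * X * Y                 ∎
  where
  open ≡-Reasoning
  regroup : ∀ m n X Y U V → m * n * (X * U + V * Y) ≡ m * X * (n * U) + n * Y * (m * V)
  regroup = solve 6 (λ m n X Y U V → m :* n :* (X :* U :+ V :* Y) := m :* X :* (n :* U) :+ n :* Y :* (m :* V)) refl
  collect : ∀ m n k X Y → m * X * (k * Y) + n * Y * (k * X) ≡ (m + n) * k * X * Y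
  collect = solve 5 (λ m n k X Y → m :* X :* (k :* Y) :+ n :* Y :* (k :* X) := (m :+ n) :* k :* X :* Y) refl

cyclicZeroPairsCount : ∀ m n h → 1 ≤ n → h < m →
  m * n * T m n h (false ∷ false ∷ []) ≡ (m + n) * (m ∸ h) * (m C h) * (n C (m ∸ h))
cyclicZeroPairsCount (suc m′) (suc n′) h _ (s≤s h≤m′) = begin
  m * n * T m n h (false ∷ false ∷ [])
    ≡⟨ cong (m * n *_) (trans (T00≡framedCounts m′ n h)
                              (cong₂ _+_ (framedCount-00 m′ n j h h+j≡m′)
                                         (framedCount-11 m′ n′ j h h+j≡m′))) ⟩
  m * n * ((m C suc j) * (n′ C j) + (m′ C j) * (n C suc j))
    ≡⟨ mn[XU+VY]≡[m+n]kXY m n (suc j) _ _ _ _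
         ([k+1]*[n+1]C[k+1]≡[n+1]*nCk m′ j) ([k+1]*[n+1]C[k+1]≡[n+1]*nCk n′ j) ⟩
  (m + n) * suc j * (m C suc j) * (n C suc j)
    ≡⟨ cong (λ k → (m + n) * k * (m C k) * (n C k)) m∸h≡1+j ⟨
  (m + n) * (m ∸ h) * (m C (m ∸ h)) * (n C (m ∸ h))
    ≡⟨ cong (λ x → (m + n) * (m ∸ h) * x * (n C (m ∸ h))) (nCk≡nC[n∸k] (m≤n⇒m≤1+n h≤m′)) ⟨
  (m + n) * (m ∸ h) * (m C h) * (n C (m ∸ h)) ∎
  where
  open ≡-Reasoning
  m = suc m′
  n = suc n′
  j = m′ ∸ h
  h+j≡m′ : h + j ≡ m′
  h+j≡m′ = m+[n∸m]≡n h≤m′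
  m∸h≡1+j : m ∸ h ≡ suc j
  m∸h≡1+j = +-∸-assoc 1 h≤m′

mainTheorem6 : (m n : ℕ) → 1 ≤ m → 1 ≤ n → 3 ≤ m + n →
    ((h : ℕ) → h < m →
      m * n * T m n h (false ∷ false ∷ []) ≡ (m + n) * (m ∸ h) * (m C h) * (n C (m ∸ h)))
  × ((h : ℕ) → h < n →
      m * n * T m n h (true ∷ true ∷ []) ≡ (m + n) * (n ∸ h) * (n C h) * (m C (n ∸ h)))
mainTheorem6 m n 1≤m 1≤n _ = (λ h h<m → cyclicZeroPairsCount m n h 1≤n h<m) , cyclicOnePairsCount
  where
  cyclicOnePairsCount : (h : ℕ) → h < n →
    m * n * T m n h (true ∷ true ∷ []) ≡ (m + n) * (n ∸ h) * (n C h) * (m C (n ∸ h))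
  cyclicOnePairsCount h h<n = begin
    m * n * T m n h (true ∷ true ∷ [])
      ≡⟨ cong₂ _*_ (*-comm m n) (T11≡T00 m n h) ⟩
    n * m * T n m h (false ∷ false ∷ [])
      ≡⟨ cyclicZeroPairsCount n m h 1≤m h<n ⟩
    (n + m) * (n ∸ h) * (n C h) * (m C (n ∸ h))
      ≡⟨ cong (λ s → s * (n ∸ h) * (n C h) * (m C (n ∸ h))) (+-comm n m) ⟩
    (m + n) * (n ∸ h) * (n C h) * (m C (n ∸ h)) ∎
    where open ≡-Reasoning
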